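{- Let $X$ and $X'$ be vertex-disjoint simple $k$-regular graphs, let $uv$ be an edge of $X$, let $u'v'$ be an edge of $X'$, and let $Y$ be the graph obtained from $X\cup X'$ by deleting the edges $uv$ and $u'v'$ and adding an edge $uu'$ and an edge $vv'$. If $\mathcal{H}$ is a Hamilton decomposition of $L(X)$ that is Euler tour compatible at $uv$ and $\mathcal{H}'$ is a Hamilton decomposition of $L(X')$ that is Euler tour compatible at $u'v'$, then there exists a Hamilton decomposition $\mathcal{H}^*$ of $L(Y)$ such that for every vertex $xy\neq uv$ of $L(X)$ at which $\mathcal{H}$ is Euler tour compatible, $\mathcal{H}^*$ is also Euler tour compatible at $xy$.
   Context: $L(X)$ denotes the line graph of $X$: its vertices are the edges of $X$, two adjacent when they share an endpoint. If a graph is regular of degree $2m$ or $2m+1$, a Hamilton decomposition is a set of $m$ pairwise edge-disjoint Hamilton cycles (so for $k$-regular $X$, a Hamilton decomposition of $L(X)$ consists of $k-1$ Hamilton cycles). For a simple graph $X$ and an edge $uv$ with $N_X(u)=\{v,a_1,\dots,a_r\}$, the $u$-neighbourhood of the vertex $uv$ in $L(X)$ is $N^u_{L(X)}(uv)=\{ua_1,\dots,ua_r\}$; the $v$-neighbourhood is defined symmetrically, and the neighbourhood of $uv$ in $L(X)$ is the disjoint union of these two. A Hamilton cycle $H$ of $L(X)$ is Euler tour compatible at the vertex $uv$ if one of the two neighbours of $uv$ on $H$ lies in the $u$-neighbourhood of $uv$ and the other lies in the $v$-neighbourhood of $uv$. A Hamilton decomposition of $L(X)$ is Euler tour compatible at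 $uv$ if each of its Hamilton cycles is Euler tour compatible at $uv$. The graph $L(Y)$ contains every edge $xy\neq uv$ of $X$ as a vertex. -}

module Defs where

open import Data.Nat using (ℕ; zero; suc; _+_; _∸_; _%_; _≤_)
open import Data.Nat.DivMod using (m%n<n)
open import Data.Fin using (Fin; toℕ; fromℕ<; splitAt; _≟_; _↑ˡ_)
open import Data.Bool using (Bool; true; false; _∧_; _∨_; not; if_then_else_)
open import Data.List using (List; map)
open import Data.Nat.ListAction using (sum)
open import Data.List using () renaming (allFin to allFinL)
open import Data.Product using (Σ; _×_; _,_; proj₁; proj₂; ∃)
open import Data.Sum using (_⊎_; inj₁; inj₂)
open import Relation.Binary.PropositionalEquality using (_≡_; _≢_)
open import Relation.Nullary using (¬_)
open import Relation.Nullary.Decidable using (⌊_⌋)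

Adj : ℕ → Set
Adj n = Fin n → Fin n → Bool

-- simple graph: symmetric, loopless (no multi-edges by construction)
IsSimple : ∀ {n} → Adj n → Set
IsSimple {n} G = (∀ x y → G x y ≡ G y x) × (∀ x → G x x ≡ false)

degree : ∀ {n} → Adj n → Fin n → ℕ
degree {n} G x = sum (map (λ y → if G x y then 1 else 0) (allFinL n))

IsRegular : ∀ {n} → ℕ → Adj n → Set
IsRegular {n} k G = ∀ x → degree G x ≡ k

-- Edges (vertices of the line graph) are represented by ordered pairs,
-- compared up to orientation.

Pair : ℕ → Set
Pair n = Fin n × Fin n

IsEdge : ∀ {n} → Adj n → Pair n → Set
IsEdge G (a , b) = G a b ≡ true

SameEdge : ∀ {n} → Pair n → Pair n → Set
SameEdge (a , b) (c , d) = (a ≡ c × b ≡ d) ⊎ (a ≡ d × b ≡ c)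

ShareEnd : ∀ {n} → Pair n → Pair n → Set
ShareEnd (a , b) (c , d) = (a ≡ c) ⊎ (a ≡ d) ⊎ (b ≡ c) ⊎ (b ≡ d)

SameLEdge : ∀ {n} → Pair n × Pair n → Pair n × Pair n → Set
SameLEdge (e , f) (e' , f') =
  (SameEdge e e' × SameEdge f f') ⊎ (SameEdge e f' × SameEdge f e')

cnext : ∀ {m} → Fin m → Fin m
cnext {suc m} i = fromℕ< (m%n<n (suc (toℕ i)) (suc m))

cprev : ∀ {m} → Fin m → Fin m
cprev {suc m} i = fromℕ< (m%n<n (toℕ i + m) (suc m))

-- A Hamilton cycle of the line graph L(G): a cyclic sequence
-- c 0, ..., c (len-1) of edges of G (len ≥ 3) in which every edge of G
-- occurs exactly once and cyclically consecutive entries are adjacent in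
-- L(G), i.e. share an endpoint (they are distinct since each edge occurs once).

record HamCycleL {n} (G : Adj n) : Set where
  field
    len     : ℕ
    len≥3   : 3 ≤ len
    c       : Fin len → Pair n
    isEdge  : ∀ i → IsEdge G (c i)
    covers  : ∀ e → IsEdge G e →
              Σ (Fin len) λ i → SameEdge (c i) e × (∀ j → SameEdge (c j) e → j ≡ i)
    consec  : ∀ i → ShareEnd (c i) (c (cnext i))

open HamCycleL public

ledge : ∀ {n} {G : Adj n} (H : HamCycleL G) → Fin (len H) → Pair n × Pair n
ledge H i = c H i , c H (cnext i)

EdgeDisjoint : ∀ {n} {G : Adj n} → HamCycleL G → HamCycleL G → Set
EdgeDisjoint H H' = ∀ i j → ¬ SameLEdge (ledge H i) (ledge H' j)

record HamDecompL {n} (k : ℕ) (G : Adj n) : Set where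
  field
    cyc      : Fin (k ∸ 1) → HamCycleL G
    disjoint : ∀ a b → a ≢ b → EdgeDisjoint (cyc a) (cyc b)

open HamDecompL public

InNbhd : ∀ {n} → Adj n → Fin n → Fin n → Pair n → Set
InNbhd {n} G u v e = Σ (Fin n) λ a → a ≢ v × G u a ≡ true × SameEdge e (u , a)

ETCompatCycle : ∀ {n} {G : Adj n} → HamCycleL G → Pair n → Set
ETCompatCycle {G = G} H (u , v) = ∀ i → SameEdge (c H i) (u , v) →
    (InNbhd G u v (c H (cprev i)) × InNbhd G v u (c H (cnext i)))
  ⊎ (InNbhd G v u (c H (cprev i)) × InNbhd G u v (c H (cnext i)))

ETCompat : ∀ {n} {k} {G : Adj n} → HamDecompL k G → Pair n → Set
ETCompat 𝓗 e = ∀ a → ETCompatCycle (cyc 𝓗 a) e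

-- The construction of Y from the disjoint union X ∪ X' (vertex set
-- Fin (n + n'), X on the first n vertices, X' on the last n').

_==_ : ∀ {n} → Fin n → Fin n → Bool
a == b = ⌊ a ≟ b ⌋

isPair : ∀ {n} → Fin n → Fin n → Fin n → Fin n → Bool
isPair x y u v = (x == u ∧ y == v) ∨ (x == v ∧ y == u)

joinY : ∀ {n n'} → Adj n → Adj n' → Fin n → Fin n → Fin n' → Fin n' →
        Adj (n + n')
joinY {n} X X' u v u' v' a b with splitAt n a | splitAt n b
... | inj₁ x | inj₁ y = X x y ∧ not (isPair x y u v)
... | inj₂ x | inj₂ y = X' x y ∧ not (isPair x y u' v')
... | inj₁ x | inj₂ y = (x == u ∧ y == u') ∨ (x == v ∧ y == v')
... | inj₂ x | inj₁ y = (y == u ∧ x == u') ∨ (y == v ∧ x == v')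

embL : ∀ {n} n' → Pair n → Pair (n + n')
embL n' (x , y) = x ↑ˡ n' , y ↑ˡ n'

module Submission where

-- Cycles of L(X) are sequences of edges of X indexed by Fin m, read cyclically.
-- 1. Anchoring: a cycle that is Euler tour compatible at uv can be rotated
--    (and, if necessary, reflected) so that uv sits at position 0, preceded by
--    an edge at u and followed by an edge at v.  Anchoring only relabels
--    positions, so it keeps the L-edges used and every compatibility.
-- 2. Splicing: for each colour, the anchored cycle of X (at uv) and of X'
--    (at v'u') are glued on Fin (L + L') into the cycle
--      vv', (X-cycle minus uv), uu', (X'-cycle minus u'v')
--    of L(Y), where Y lives on Fin (n + n') with X left and X' right.
-- 3. Disjointness: each L-edge of a spliced cycle projects, under a vertex
--    map π : Y → X or π' : Y → X' that sends both new edges to the deleted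
--    edge, onto an L-edge of the anchored cycle of the same colour; which
--    projection applies is decided by whether the L-edge touches X.
-- 4. Compatibility at an old edge xy of X: its neighbours in the spliced
--    cycle are those of the anchored cycle, with uv replaced by the new edge
--    at the common endpoint.

open import Defs
open import Data.Nat using (ℕ; zero; suc; _+_; _∸_; _%_; _≤_; _<_; s≤s; z≤n; s≤s⁻¹)
open import Data.Nat.Properties
  using (≤-trans; n≤1+n; n<1+n; +-suc; suc-injective; m≤n⇒m<n∨m≡n; +-∸-assoc; n∸n≡0;
         <⇒≱; m≤m+n; +-identityʳ; +-monoʳ-<)
open import Data.Nat.DivMod using (m<n⇒m%n≡m; n%n≡0; [m+n]%n≡m%n)
open import Data.Fin using (Fin; toℕ; zero; suc; opposite; splitAt; join; _↑ˡ_; _↑ʳ_; _≟_)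
open import Data.Fin.Properties using (toℕ-injective; toℕ-fromℕ<; toℕ<n; opposite-prop; opposite-involutive;
         join-splitAt; toℕ-↑ˡ; toℕ-↑ʳ; splitAt-↑ˡ; splitAt-↑ʳ; ↑ˡ-injective)
open import Data.Sum using (_⊎_; inj₁; inj₂)
open import Data.Product using (Σ; _×_; _,_; proj₁)
open import Data.Empty using (⊥; ⊥-elim)
open import Data.Bool using (Bool; true; false; _∧_; _∨_; not; if_then_else_)
open import Data.Bool.Properties using (∧-comm; ∨-comm; ∨-zeroʳ)
open import Relation.Nullary using (¬_; yes; no)
open import Relation.Binary.PropositionalEquality
open ≡-Reasoning

toℕ-cnext-< : ∀ {m} (i : Fin m) → suc (toℕ i) < m → toℕ (cnext i) ≡ suc (toℕ i)
toℕ-cnext-< {suc m} i lt = trans (toℕ-fromℕ< _) (m<n⇒m%n≡m lt)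

toℕ-cnext-wrap : ∀ {m} (i : Fin m) → suc (toℕ i) ≡ m → toℕ (cnext i) ≡ 0
toℕ-cnext-wrap {suc m} i eq =
  trans (toℕ-fromℕ< _) (trans (cong (_% suc m) eq) (n%n≡0 (suc m)))

toℕ-cprev-suc : ∀ {m} (i : Fin m) t → toℕ i ≡ suc t → toℕ (cprev i) ≡ t
toℕ-cprev-suc {suc m} i t eq = begin
  toℕ (cprev i)          ≡⟨ toℕ-fromℕ< _ ⟩
  (toℕ i + m) % suc m    ≡⟨ cong (λ z → (z + m) % suc m) eq ⟩
  (suc t + m) % suc m    ≡⟨ cong (_% suc m) (sym (+-suc t m)) ⟩
  (t + suc m) % suc m    ≡⟨ [m+n]%n≡m%n t (suc m) ⟩
  t % suc m              ≡⟨ m<n⇒m%n≡m t<1+m ⟩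
  t                      ∎
  where
  t<1+m : t < suc m
  t<1+m = ≤-trans (n≤1+n (suc t)) (subst (_< suc m) eq (toℕ<n i))

toℕ-cprev-zero : ∀ {m} (i : Fin (suc m)) → toℕ i ≡ 0 → toℕ (cprev i) ≡ m
toℕ-cprev-zero {m} i eq = trans (toℕ-fromℕ< _)
  (trans (cong (λ z → (z + m) % suc m) eq) (m<n⇒m%n≡m (n<1+n m)))

cnext-cprev : ∀ {m} (i : Fin m) → cnext (cprev i) ≡ i
cnext-cprev {suc m} i = by-cases (toℕ i) refl
  where
  by-cases : ∀ k → toℕ i ≡ k → cnext (cprev i) ≡ i
  by-cases zero eq = toℕ-injective
    (trans (toℕ-cnext-wrap (cprev i) (cong suc (toℕ-cprev-zero i eq))) (sym eq))
  by-cases (suc t) eq = toℕ-injective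
    (trans (toℕ-cnext-< (cprev i) lt) (trans (cong suc prev) (sym eq)))
    where
    prev : toℕ (cprev i) ≡ t
    prev = toℕ-cprev-suc i t eq
    lt : suc (toℕ (cprev i)) < suc m
    lt = subst (λ z → suc z < suc m) (sym prev) (subst (_< suc m) eq (toℕ<n i))

cprev-cnext : ∀ {m} (i : Fin m) → cprev (cnext i) ≡ i
cprev-cnext {suc m} i with m≤n⇒m<n∨m≡n (toℕ<n i)
... | inj₁ lt = toℕ-injective (toℕ-cprev-suc (cnext i) (toℕ i) (toℕ-cnext-< i lt))
... | inj₂ eq = toℕ-injective
  (trans (toℕ-cprev-zero (cnext i) (toℕ-cnext-wrap i eq)) (sym (suc-injective eq)))

cnext⇒cprev : ∀ {m} {i j : Fin m} → cnext i ≡ j → i ≡ cprev j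
cnext⇒cprev {i = i} refl = sym (cprev-cnext i)

rotate : ∀ {m} → ℕ → Fin m → Fin m
rotate zero    j = j
rotate (suc p) j = cnext (rotate p j)

unrotate : ∀ {m} → ℕ → Fin m → Fin m
unrotate zero    j = j
unrotate (suc p) j = unrotate p (cprev j)

rotate-cnext : ∀ {m} p (j : Fin m) → rotate p (cnext j) ≡ cnext (rotate p j)
rotate-cnext zero    j = refl
rotate-cnext (suc p) j = cong cnext (rotate-cnext p j)

unrotate-rotate : ∀ {m} p (j : Fin m) → unrotate p (rotate p j) ≡ j
unrotate-rotate zero    j = refl
unrotate-rotate (suc p) j =
  trans (cong (unrotate p) (cprev-cnext (rotate p j))) (unrotate-rotate p j)

rotate-unrotate : ∀ {m} p (j : Fin m) → rotate p (unrotate p j) ≡ j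
rotate-unrotate zero    j = refl
rotate-unrotate (suc p) j =
  trans (cong cnext (rotate-unrotate p (cprev j))) (cnext-cprev j)

rotate-toℕ : ∀ {m} (i : Fin (suc m)) → rotate (toℕ i) zero ≡ i
rotate-toℕ {m} i = toℕ-injective (go (toℕ i) (toℕ<n i))
  where
  go : ∀ p → p < suc m → toℕ (rotate {suc m} p zero) ≡ p
  go zero    _  = refl
  go (suc p) lt = trans (toℕ-cnext-< (rotate p zero) (subst (λ z → suc z < suc m) (sym ih) lt))
                        (cong suc ih)
    where ih = go p (≤-trans (n≤1+n (suc p)) lt)

opposite-cnext : ∀ {m} (j : Fin m) → opposite (cnext j) ≡ cprev (opposite j)
opposite-cnext {suc m} j with m≤n⇒m<n∨m≡n (toℕ<n j)
... | inj₁ lt = toℕ-injective (begin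
  toℕ (opposite (cnext j))    ≡⟨ opposite-prop (cnext j) ⟩
  m ∸ toℕ (cnext j)           ≡⟨ cong (m ∸_) (toℕ-cnext-< j lt) ⟩
  m ∸ suc (toℕ j)             ≡⟨ toℕ-cprev-suc (opposite j) (m ∸ suc (toℕ j)) opp ⟨
  toℕ (cprev (opposite j))    ∎)
  where
  opp : toℕ (opposite j) ≡ suc (m ∸ suc (toℕ j))
  opp = trans (opposite-prop j) (+-∸-assoc 1 (s≤s⁻¹ lt))
... | inj₂ eq = toℕ-injective (begin
  toℕ (opposite (cnext j))    ≡⟨ opposite-prop (cnext j) ⟩
  m ∸ toℕ (cnext j)           ≡⟨ cong (m ∸_) (toℕ-cnext-wrap j eq) ⟩
  m                           ≡⟨ toℕ-cprev-zero (opposite j) opp ⟨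
  toℕ (cprev (opposite j))    ∎)
  where
  opp : toℕ (opposite j) ≡ 0
  opp = trans (opposite-prop j) (trans (cong (m ∸_) (suc-injective eq)) (n∸n≡0 m))

last : ∀ {k} → Fin (suc k)
last = cprev zero

toℕ-last : ∀ {k} → toℕ (last {k}) ≡ k
toℕ-last = toℕ-cprev-zero zero refl

cnext-last : ∀ {k} → cnext (last {k}) ≡ zero
cnext-last = cnext-cprev zero

last≢zero : ∀ {k} → last {suc k} ≢ zero
last≢zero eq with trans (sym toℕ-last) (cong toℕ eq)
... | ()

<-last : ∀ {k} (i : Fin (suc k)) → i ≢ last → suc (toℕ i) < suc k
<-last i i≢last with m≤n⇒m<n∨m≡n (toℕ<n i)
... | inj₁ lt = lt
... | inj₂ eq = ⊥-elim (i≢last (toℕ-injective (trans (suc-injective eq) (sym toℕ-last))))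

cnext≢zero : ∀ {k} (i : Fin (suc k)) → i ≢ last → cnext i ≢ zero
cnext≢zero i i≢last eq = i≢last (trans (sym (cprev-cnext i)) (cong cprev eq))

cprev≢last : ∀ {k} (i : Fin (suc k)) → i ≢ zero → cprev i ≢ last
cprev≢last i i≢0 eq = i≢0 (trans (sym (cnext-cprev i)) (trans (cong cnext eq) cnext-last))

module _ {n : ℕ} where

  same-refl : (p : Pair n) → SameEdge p p
  same-refl _ = inj₁ (refl , refl)

  same-≡ : {p q : Pair n} → p ≡ q → SameEdge p q
  same-≡ refl = same-refl _

  same-swap : (a b : Fin n) → SameEdge (a , b) (b , a)
  same-swap _ _ = inj₂ (refl , refl)

  same-sym : {p q : Pair n} → SameEdge p q → SameEdge q p
  same-sym (inj₁ (refl , refl)) = inj₁ (refl , refl)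
  same-sym (inj₂ (refl , refl)) = inj₂ (refl , refl)

  same-trans : {p q r : Pair n} → SameEdge p q → SameEdge q r → SameEdge p r
  same-trans (inj₁ (refl , refl)) s                    = s
  same-trans (inj₂ (refl , refl)) (inj₁ (refl , refl)) = inj₂ (refl , refl)
  same-trans (inj₂ (refl , refl)) (inj₂ (refl , refl)) = inj₁ (refl , refl)

  sameL-sym : {P Q : Pair n × Pair n} → SameLEdge P Q → SameLEdge Q P
  sameL-sym (inj₁ (a , b)) = inj₁ (same-sym a , same-sym b)
  sameL-sym (inj₂ (a , b)) = inj₂ (same-sym b , same-sym a)

  sameL-trans : {P Q R : Pair n × Pair n} → SameLEdge P Q → SameLEdge Q R → SameLEdge P R
  sameL-trans (inj₁ (a , b)) (inj₁ (c , d)) = inj₁ (same-trans a c , same-trans b d)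
  sameL-trans (inj₁ (a , b)) (inj₂ (c , d)) = inj₂ (same-trans a c , same-trans b d)
  sameL-trans (inj₂ (a , b)) (inj₁ (c , d)) = inj₂ (same-trans a d , same-trans b c)
  sameL-trans (inj₂ (a , b)) (inj₂ (c , d)) = inj₁ (same-trans a d , same-trans b c)

  share-sym : {p q : Pair n} → ShareEnd p q → ShareEnd q p
  share-sym (inj₁ refl)                = inj₁ refl
  share-sym (inj₂ (inj₁ refl))         = inj₂ (inj₂ (inj₁ refl))
  share-sym (inj₂ (inj₂ (inj₁ refl)))  = inj₂ (inj₁ refl)
  share-sym (inj₂ (inj₂ (inj₂ refl)))  = inj₂ (inj₂ (inj₂ refl))

  Incident : Fin n → Pair n → Set
  Incident w (a , b) = (w ≡ a) ⊎ (w ≡ b)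

  incident-same : {w : Fin n} {p q : Pair n} → Incident w p → SameEdge p q → Incident w q
  incident-same i            (inj₁ (refl , refl)) = i
  incident-same (inj₁ refl)  (inj₂ (refl , refl)) = inj₂ refl
  incident-same (inj₂ refl)  (inj₂ (refl , refl)) = inj₁ refl

  share-at : {w : Fin n} {p q : Pair n} → Incident w p → Incident w q → ShareEnd p q
  share-at (inj₁ refl) (inj₁ refl) = inj₁ refl
  share-at (inj₁ refl) (inj₂ refl) = inj₂ (inj₁ refl)
  share-at (inj₂ refl) (inj₁ refl) = inj₂ (inj₂ (inj₁ refl))
  share-at (inj₂ refl) (inj₂ refl) = inj₂ (inj₂ (inj₂ refl))

  nbhd-incident : (G : Adj n) {a b : Fin n} {p : Pair n} → InNbhd G a b p → Incident a p
  nbhd-incident _ (_ , _ , _ , s) = incident-same (inj₁ refl) (same-sym s)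

  nbhd-endpoint : (G : Adj n) {a b z w β : Fin n} {p : Pair n} →
    InNbhd G a b p → SameEdge p (z , w) → SameEdge (a , b) (w , β) → β ≢ z → a ≡ w
  nbhd-endpoint _ _ _ (inj₁ (a≡w , _)) _ = a≡w
  nbhd-endpoint _ (α , _ , _ , s) p≈zw (inj₂ (refl , refl)) β≢z with same-trans (same-sym s) p≈zw
  ... | inj₁ (refl , _) = ⊥-elim (β≢z refl)
  ... | inj₂ (a≡w , _)  = a≡w

  Flanked : Adj n → Pair n → Pair n → Pair n → Set
  Flanked G (u , v) p q = (InNbhd G u v p × InNbhd G v u q) ⊎ (InNbhd G v u p × InNbhd G u v q)

  flanked-swap : {G : Adj n} {u v : Fin n} {p q : Pair n} →
    Flanked G (u , v) p q → Flanked G (v , u) p q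
  flanked-swap (inj₁ f) = inj₂ f
  flanked-swap (inj₂ f) = inj₁ f

  flanked-reverse : {G : Adj n} {e p q : Pair n} → Flanked G e p q → Flanked G e q p
  flanked-reverse (inj₁ (x , y)) = inj₂ (y , x)
  flanked-reverse (inj₂ (x , y)) = inj₁ (y , x)

mapPair : ∀ {a b} → (Fin a → Fin b) → Pair a → Pair b
mapPair f (x , y) = f x , f y

mapLEdge : ∀ {a b} → (Fin a → Fin b) → Pair a × Pair a → Pair b × Pair b
mapLEdge f (p , q) = mapPair f p , mapPair f q

module _ {a b : ℕ} (f : Fin a → Fin b) where

  mapPair-same : {p q : Pair a} → SameEdge p q → SameEdge (mapPair f p) (mapPair f q)
  mapPair-same (inj₁ (refl , refl)) = inj₁ (refl , refl)
  mapPair-same (inj₂ (refl , refl)) = inj₂ (refl , refl)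

  mapPair-same⁻ : (∀ x y → f x ≡ f y → x ≡ y) →
    {p q : Pair a} → SameEdge (mapPair f p) (mapPair f q) → SameEdge p q
  mapPair-same⁻ inj {_ , _} {_ , _} (inj₁ (e₁ , e₂)) = inj₁ (inj _ _ e₁ , inj _ _ e₂)
  mapPair-same⁻ inj {_ , _} {_ , _} (inj₂ (e₁ , e₂)) = inj₂ (inj _ _ e₁ , inj _ _ e₂)

  mapPair-incident : {w : Fin a} {p : Pair a} → Incident w p → Incident (f w) (mapPair f p)
  mapPair-incident (inj₁ refl) = inj₁ refl
  mapPair-incident (inj₂ refl) = inj₂ refl

  mapPair-share : {p q : Pair a} → ShareEnd p q → ShareEnd (mapPair f p) (mapPair f q)
  mapPair-share (inj₁ refl)               = inj₁ refl
  mapPair-share (inj₂ (inj₁ refl))        = inj₂ (inj₁ refl)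
  mapPair-share (inj₂ (inj₂ (inj₁ refl))) = inj₂ (inj₂ (inj₁ refl))
  mapPair-share (inj₂ (inj₂ (inj₂ refl))) = inj₂ (inj₂ (inj₂ refl))

  mapLEdge-same : {P Q : Pair a × Pair a} → SameLEdge P Q → SameLEdge (mapLEdge f P) (mapLEdge f Q)
  mapLEdge-same (inj₁ (s , t)) = inj₁ (mapPair-same s , mapPair-same t)
  mapLEdge-same (inj₂ (s , t)) = inj₂ (mapPair-same s , mapPair-same t)

flanked-transfer : ∀ {n N} {G : Adj n} {Y : Adj N} (f : Fin n → Fin N) {x y : Fin n}
  {p q : Pair n} {p' q' : Pair N} →
  (∀ {a b} → SameEdge (x , y) (a , b) → InNbhd G a b p → InNbhd Y (f a) (f b) p') →
  (∀ {a b} → SameEdge (x , y) (a , b) → InNbhd G a b q → InNbhd Y (f a) (f b) q') →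
  Flanked G (x , y) p q → Flanked Y (f x , f y) p' q'
flanked-transfer f P Q (inj₁ (xp , yq)) = inj₁ (P (same-refl _) xp , Q (same-swap _ _) yq)
flanked-transfer f P Q (inj₂ (yp , xq)) = inj₂ (P (same-swap _ _) yp , Q (same-refl _) xq)

-- Hamilton cycles of a fixed length: HamCycleL with its length moved into
-- the type, so that cycles can be relabelled along bijections of Fin m.

Covers : ∀ {n m} → Adj n → (Fin m → Pair n) → Set
Covers {m = m} G c =
  ∀ e → IsEdge G e → Σ (Fin m) λ i → SameEdge (c i) e × (∀ j → SameEdge (c j) e → j ≡ i)

record CycleL {n} (G : Adj n) (m : ℕ) : Set where
  field
    seq        : Fin m → Pair n
    seq-edge   : ∀ i → IsEdge G (seq i)
    seq-covers : Covers G seq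
    seq-consec : ∀ i → ShareEnd (seq i) (seq (cnext i))

open CycleL public

module _ {n} {G : Adj n} where

  fromHam : (H : HamCycleL G) → CycleL G (len H)
  fromHam H = record
    { seq = c H ; seq-edge = isEdge H ; seq-covers = covers H ; seq-consec = consec H }

  toHam : ∀ {m} → 3 ≤ m → CycleL G m → HamCycleL G
  toHam {m} 3≤m C = record
    { len = m ; len≥3 = 3≤m ; c = seq C ; isEdge = seq-edge C
    ; covers = seq-covers C ; consec = seq-consec C }

  lstep : ∀ {m} → CycleL G m → Fin m → Pair n × Pair n
  lstep C i = seq C i , seq C (cnext i)

  ETC : ∀ {m} → CycleL G m → Pair n → Set
  ETC C e = ∀ i → SameEdge (seq C i) e → Flanked G e (seq C (cprev i)) (seq C (cnext i))

  etc-swap : ∀ {m} (C : CycleL G m) {a b : Fin n} → ETC C (a , b) → ETC C (b , a)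
  etc-swap C E i s = flanked-swap (E i (same-trans s (same-swap _ _)))

  seq-injective : ∀ {m} (C : CycleL G m) {i j : Fin m} → SameEdge (seq C i) (seq C j) → i ≡ j
  seq-injective C {i} {j} s =
    let (_ , _ , unique) = seq-covers C (seq C j) (seq-edge C j)
    in trans (unique i s) (sym (unique j (same-refl _)))

  record Refines {m m'} (D : CycleL G m') (C : CycleL G m) : Set where
    field
      lstep-from : ∀ j → Σ (Fin m) λ i → SameLEdge (lstep D j) (lstep C i)
      etc-from   : ∀ e → ETC C e → ETC D e

  open Refines public

  refines-trans : ∀ {m m' m''} {E : CycleL G m''} {D : CycleL G m'} {C : CycleL G m} →
    Refines E D → Refines D C → Refines E C
  refines-trans ED DC = record
    { lstep-from = λ k →
        let (j , s) = lstep-from ED k ; (i , t) = lstep-from DC j in i , sameL-trans s t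
    ; etc-from = λ e E → etc-from ED e (etc-from DC e E) }

  module Relabel {m m'} (C : CycleL G m) (σ : Fin m' → Fin m) (τ : Fin m → Fin m')
                 (στ : ∀ i → σ (τ i) ≡ i) (τσ : ∀ j → τ (σ j) ≡ j) where

    relabel-covers : Covers G (λ j → seq C (σ j))
    relabel-covers e ie =
      let (i , s , unique) = seq-covers C e ie in
      τ i , subst (λ z → SameEdge (seq C z) e) (sym (στ i)) s ,
      λ j sj → trans (sym (τσ j)) (cong τ (unique (σ j) sj))

    module Rotation (comm : ∀ j → σ (cnext j) ≡ cnext (σ j)) where

      comm-prev : ∀ j → σ (cprev j) ≡ cprev (σ j)
      comm-prev j = cnext⇒cprev (trans (sym (comm (cprev j))) (cong σ (cnext-cprev j)))

      cycle : CycleL G m'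
      cycle = record
        { seq = λ j → seq C (σ j)
        ; seq-edge = λ j → seq-edge C (σ j)
        ; seq-covers = relabel-covers
        ; seq-consec = λ j →
            subst (λ z → ShareEnd (seq C (σ j)) (seq C z)) (sym (comm j)) (seq-consec C (σ j)) }

      refines : Refines cycle C
      refines = record
        { lstep-from = λ j → σ j , inj₁ (same-refl _ , same-≡ (cong (seq C) (comm j)))
        ; etc-from = λ e E j s →
            subst₂ (Flanked G e) (cong (seq C) (sym (comm-prev j))) (cong (seq C) (sym (comm j)))
              (E (σ j) s) }

    module Reflection (comm : ∀ j → σ (cnext j) ≡ cprev (σ j)) where

      comm-prev : ∀ j → σ (cprev j) ≡ cnext (σ j)
      comm-prev j = trans (sym (cnext-cprev (σ (cprev j))))
        (cong cnext (trans (sym (comm (cprev j))) (cong σ (cnext-cprev j))))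

      cycle : CycleL G m'
      cycle = record
        { seq = λ j → seq C (σ j)
        ; seq-edge = λ j → seq-edge C (σ j)
        ; seq-covers = relabel-covers
        ; seq-consec = λ j → subst₂ (λ y z → ShareEnd (seq C y) (seq C z))
            (cnext-cprev (σ j)) (sym (comm j)) (share-sym (seq-consec C (cprev (σ j)))) }

      refines : Refines cycle C
      refines = record
        { lstep-from = λ j → cprev (σ j) ,
            inj₂ (same-≡ (cong (seq C) (sym (cnext-cprev (σ j)))) , same-≡ (cong (seq C) (comm j)))
        ; etc-from = λ e E j s →
            subst₂ (Flanked G e) (cong (seq C) (sym (comm-prev j))) (cong (seq C) (sym (comm j)))
              (flanked-reverse {G = G} (E (σ j) s)) }

module _ {n} {G : Adj n} where

  record Anchored {L} (C : CycleL G L) (s t : Fin n) : Set where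
    field
      m       : ℕ
      tour    : CycleL G (suc (suc (suc m)))
      at-zero : SameEdge (seq tour zero) (s , t)
      before  : InNbhd G s t (seq tour last)
      after   : InNbhd G t s (seq tour (cnext zero))
      refines : Refines tour C

  anchored-lift : ∀ {L L'} {C : CycleL G L} {C' : CycleL G L'} {s t : Fin n} →
    Refines C C' → Anchored C s t → Anchored C' s t
  anchored-lift CC' A = record
    { m = m ; tour = tour ; at-zero = at-zero ; before = before ; after = after
    ; refines = refines-trans refines CC' }
    where open Anchored A

  anchor-at : ∀ {m} {s t : Fin n} (C : CycleL G (suc (suc (suc m)))) (i : Fin (suc (suc (suc m)))) →
    SameEdge (seq C i) (s , t) → InNbhd G s t (seq C (cprev i)) → InNbhd G t s (seq C (cnext i)) →
    Anchored C s t
  anchor-at {m} {s} {t} C i at bef aft = record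
    { m = m
    ; tour = cycle
    ; at-zero = subst (λ z → SameEdge (seq C z) (s , t)) (sym start) at
    ; before = subst (λ z → InNbhd G s t (seq C z)) (sym (trans (comm-prev zero) (cong cprev start))) bef
    ; after = subst (λ z → InNbhd G t s (seq C z)) (sym (trans (rotate-cnext p zero) (cong cnext start))) aft
    ; refines = refines }
    where
    p = toℕ i
    open Relabel C (rotate p) (unrotate p) (rotate-unrotate p) (unrotate-rotate p)
    open Rotation (rotate-cnext p)
    start : rotate p zero ≡ i
    start = rotate-toℕ i

  -- the occurrence of st is flanked one way or the other; in the second
  -- case reflect the cycle first
  anchor : ∀ {L} (C : CycleL G L) → 3 ≤ L → {s t : Fin n} → IsEdge G (s , t) → ETC C (s , t) →
    Anchored C s t
  anchor C (s≤s (s≤s (s≤s _))) {s} {t} st E with seq-covers C (s , t) st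
  ... | i , at , _ with E i at
  ...   | inj₁ (bef , aft) = anchor-at C i at bef aft
  ...   | inj₂ (aft , bef) = anchored-lift V.refines
          (anchor-at V.cycle (opposite i)
            (subst (λ z → SameEdge (seq C z) (s , t)) (sym oo) at)
            (subst (λ z → InNbhd G s t (seq C z)) (sym (trans (V.comm-prev (opposite i)) (cong cnext oo))) bef)
            (subst (λ z → InNbhd G t s (seq C z)) (sym (trans (opposite-cnext (opposite i)) (cong cprev oo))) aft))
    where
    module V = Relabel.Reflection C opposite opposite opposite-involutive opposite-involutive opposite-cnext
    oo : opposite (opposite i) ≡ i
    oo = opposite-involutive i

-- Anchored versions of the cycles of a Hamilton decomposition still have no
-- L-edge in common, since they only use L-edges of the original cycles.
anchored-disjoint : ∀ {n k} {G : Adj n} (𝓓 : HamDecompL k G) {s t : Fin n}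
  (B : ∀ a → Anchored (fromHam (cyc 𝓓 a)) s t) → ∀ a b → a ≢ b →
  ∀ i j → ¬ SameLEdge (lstep (Anchored.tour (B a)) i) (lstep (Anchored.tour (B b)) j)
anchored-disjoint 𝓓 B a b a≢b i j shared =
  let (i' , i≈) = lstep-from (Anchored.refines (B a)) i
      (j' , j≈) = lstep-from (Anchored.refines (B b)) j
  in disjoint 𝓓 a b a≢b i' j' (sameL-trans (sameL-sym i≈) (sameL-trans shared j≈))

module _ {a b : ℕ} where

  data Side : Fin (a + b) → Set where
    left  : (i : Fin a) → Side (i ↑ˡ b)
    right : (j : Fin b) → Side (a ↑ʳ j)

  side : (w : Fin (a + b)) → Side w
  side w = from-split (splitAt a w) (join-splitAt a b w)
    where
    from-split : (s : Fin a ⊎ Fin b) → join a b s ≡ w → Side w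
    from-split (inj₁ i) refl = left i
    from-split (inj₂ j) refl = right j

  left≢right : (i : Fin a) (j : Fin b) → i ↑ˡ b ≢ a ↑ʳ j
  left≢right i j eq = <⇒≱ (toℕ<n i) (subst (a ≤_) toℕ-eq (m≤m+n a (toℕ j)))
    where
    toℕ-eq : a + toℕ j ≡ toℕ i
    toℕ-eq = trans (sym (toℕ-↑ʳ a j)) (trans (cong toℕ (sym eq)) (toℕ-↑ˡ i b))

  left≁right : (p : Pair a) (q : Pair b) → ¬ SameEdge (mapPair (_↑ˡ b) p) (mapPair (a ↑ʳ_) q)
  left≁right (x , _) (y , _) (inj₁ (e , _)) = left≢right x y e
  left≁right (x , _) (_ , y) (inj₂ (e , _)) = left≢right x y e

  left≁cross : (p : Pair a) (i : Fin a) (j : Fin b) → ¬ SameEdge (mapPair (_↑ˡ b) p) (i ↑ˡ b , a ↑ʳ j)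
  left≁cross (_ , y) i j (inj₁ (_ , e)) = left≢right y j e
  left≁cross (x , _) i j (inj₂ (e , _)) = left≢right x j e

  cross≁right : (i : Fin a) (j : Fin b) (q : Pair b) → ¬ SameEdge (i ↑ˡ b , a ↑ʳ j) (mapPair (a ↑ʳ_) q)
  cross≁right i j (y , _) (inj₁ (e , _)) = left≢right i y e
  cross≁right i j (_ , y) (inj₂ (e , _)) = left≢right i y e

  isLeft : Fin (a + b) → Bool
  isLeft w = from-split (splitAt a w)
    where
    from-split : Fin a ⊎ Fin b → Bool
    from-split (inj₁ _) = true
    from-split (inj₂ _) = false

  isLeft-↑ˡ : ∀ i → isLeft (i ↑ˡ b) ≡ true
  isLeft-↑ˡ i rewrite splitAt-↑ˡ a i b = refl

  isLeft-↑ʳ : ∀ j → isLeft (a ↑ʳ j) ≡ false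
  isLeft-↑ʳ j rewrite splitAt-↑ʳ a b j = refl

  isLeftEdge : Pair (a + b) → Bool
  isLeftEdge (w₁ , w₂) = isLeft w₁ ∧ isLeft w₂

  isLeftEdge-same : {p q : Pair (a + b)} → SameEdge p q → isLeftEdge p ≡ isLeftEdge q
  isLeftEdge-same (inj₁ (refl , refl))         = refl
  isLeftEdge-same {w₁ , w₂} (inj₂ (refl , refl)) = ∧-comm (isLeft w₁) (isLeft w₂)

  isLeftEdge-↑ˡ : (p : Pair a) → isLeftEdge (mapPair (_↑ˡ b) p) ≡ true
  isLeftEdge-↑ˡ (x , y) = cong₂ _∧_ (isLeft-↑ˡ x) (isLeft-↑ˡ y)

  isLeftEdge-↑ʳ : (p : Pair b) → isLeftEdge (mapPair (a ↑ʳ_) p) ≡ false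
  isLeftEdge-↑ʳ (x , y) = cong (_∧ isLeft (a ↑ʳ y)) (isLeft-↑ʳ x)

  isLeftEdge-cross : (i : Fin a) (j : Fin b) → isLeftEdge (i ↑ˡ b , a ↑ʳ j) ≡ false
  isLeftEdge-cross i j = cong₂ _∧_ (isLeft-↑ˡ i) (isLeft-↑ʳ j)

cnext-↑ˡ : ∀ {a b} (i : Fin (suc a)) → i ≢ last → cnext (i ↑ˡ b) ≡ cnext i ↑ˡ b
cnext-↑ˡ {a} {b} i i≢last = toℕ-injective (begin
  toℕ (cnext (i ↑ˡ b))  ≡⟨ toℕ-cnext-< (i ↑ˡ b) (subst (λ z → suc z < suc a + b) (sym (toℕ-↑ˡ i b)) lt) ⟩
  suc (toℕ (i ↑ˡ b))    ≡⟨ cong suc (toℕ-↑ˡ i b) ⟩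
  suc (toℕ i)           ≡⟨ toℕ-cnext-< i (<-last i i≢last) ⟨
  toℕ (cnext i)         ≡⟨ toℕ-↑ˡ (cnext i) b ⟨
  toℕ (cnext i ↑ˡ b)    ∎)
  where
  lt : suc (toℕ i) < suc a + b
  lt = ≤-trans (<-last i i≢last) (m≤m+n (suc a) b)

cnext-↑ˡ-last : ∀ {a b} → cnext (last {a} ↑ˡ suc b) ≡ suc a ↑ʳ zero
cnext-↑ˡ-last {a} {b} = toℕ-injective (begin
  toℕ (cnext (last ↑ˡ suc b))  ≡⟨ toℕ-cnext-< (last ↑ˡ suc b) lt ⟩
  suc (toℕ (last ↑ˡ suc b))    ≡⟨ cong suc (trans (toℕ-↑ˡ last (suc b)) toℕ-last) ⟩
  suc a                        ≡⟨ +-identityʳ (suc a) ⟨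
  suc a + 0                    ≡⟨ toℕ-↑ʳ (suc a) (zero {b}) ⟨
  toℕ (suc a ↑ʳ zero)          ∎)
  where
  lt : suc (toℕ (last {a} ↑ˡ suc b)) < suc a + suc b
  lt = subst (λ z → suc z < suc a + suc b) (sym (trans (toℕ-↑ˡ (last {a}) (suc b)) toℕ-last))
         (subst (_< suc a + suc b) (+-identityʳ (suc a)) (+-monoʳ-< (suc a) (s≤s z≤n)))

cnext-↑ʳ : ∀ {a b} (j : Fin (suc b)) → j ≢ last → cnext (a ↑ʳ j) ≡ a ↑ʳ cnext j
cnext-↑ʳ {a} {b} j j≢last = toℕ-injective (begin
  toℕ (cnext (a ↑ʳ j))   ≡⟨ toℕ-cnext-< (a ↑ʳ j) lt ⟩
  suc (toℕ (a ↑ʳ j))     ≡⟨ cong suc (toℕ-↑ʳ a j) ⟩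
  suc (a + toℕ j)        ≡⟨ +-suc a (toℕ j) ⟨
  a + suc (toℕ j)        ≡⟨ cong (a +_) (toℕ-cnext-< j (<-last j j≢last)) ⟨
  a + toℕ (cnext j)      ≡⟨ toℕ-↑ʳ a (cnext j) ⟨
  toℕ (a ↑ʳ cnext j)     ∎)
  where
  lt : suc (toℕ (a ↑ʳ j)) < a + suc b
  lt = subst (λ z → suc z < a + suc b) (sym (toℕ-↑ʳ a j))
         (subst (_< a + suc b) (+-suc a (toℕ j)) (+-monoʳ-< a (<-last j j≢last)))

cnext-↑ʳ-last : ∀ {a b} → cnext (suc a ↑ʳ last {b}) ≡ zero ↑ˡ suc b
cnext-↑ʳ-last {a} {b} = toℕ-injective (toℕ-cnext-wrap (suc a ↑ʳ last) (begin
  suc (toℕ (suc a ↑ʳ last))  ≡⟨ cong suc (toℕ-↑ʳ (suc a) last) ⟩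
  suc (suc a + toℕ last)     ≡⟨ cong (λ z → suc (suc a + z)) toℕ-last ⟩
  suc (suc a + b)            ≡⟨ +-suc (suc a) b ⟨
  suc a + suc b              ∎))

cprev-↑ˡ : ∀ {a b} (i : Fin (suc a)) → i ≢ zero → cprev (i ↑ˡ b) ≡ cprev i ↑ˡ b
cprev-↑ˡ i i≢0 = sym (cnext⇒cprev
  (trans (cnext-↑ˡ (cprev i) (cprev≢last i i≢0)) (cong (_↑ˡ _) (cnext-cprev i))))

∧-true : ∀ {a b} → a ∧ b ≡ true → a ≡ true × b ≡ true
∧-true {true} {true} _ = refl , refl

∨-true : ∀ {a b} → a ∨ b ≡ true → a ≡ true ⊎ b ≡ true
∨-true {true}  _ = inj₁ refl
∨-true {false} e = inj₂ e

∨-trueˡ : ∀ {a b} → a ≡ true → a ∨ b ≡ true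
∨-trueˡ refl = refl

∨-trueʳ : ∀ {a b} → b ≡ true → a ∨ b ≡ true
∨-trueʳ {a} refl = ∨-zeroʳ a

true-and-false : ∀ {b} → b ≡ true → b ≡ false → ⊥
true-and-false refl ()

not-true : ∀ {b} → not b ≡ true → b ≡ true → ⊥
not-true {false} _ ()

module _ {n : ℕ} where

  ==-refl : (a : Fin n) → (a == a) ≡ true
  ==-refl a with a ≟ a
  ... | yes _   = refl
  ... | no a≢a  = ⊥-elim (a≢a refl)

  ==-false : {a b : Fin n} → a ≢ b → (a == b) ≡ false
  ==-false {a} {b} a≢b with a ≟ b
  ... | yes a≡b = ⊥-elim (a≢b a≡b)
  ... | no _    = refl

  ==-sound : {a b : Fin n} → (a == b) ≡ true → a ≡ b
  ==-sound {a} {b} _ with a ≟ b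
  ==-sound         _  | yes a≡b = a≡b
  ==-sound         () | no _

  isPair-sound : {x y a b : Fin n} → isPair x y a b ≡ true → SameEdge (x , y) (a , b)
  isPair-sound e with ∨-true e
  ... | inj₁ e₁ = let (p , q) = ∧-true e₁ in inj₁ (==-sound p , ==-sound q)
  ... | inj₂ e₂ = let (p , q) = ∧-true e₂ in inj₂ (==-sound p , ==-sound q)

  isPair-true : {x y a b : Fin n} → SameEdge (x , y) (a , b) → isPair x y a b ≡ true
  isPair-true {x} {y} (inj₁ (refl , refl)) rewrite ==-refl x | ==-refl y = refl
  isPair-true {x} {y} (inj₂ (refl , refl)) rewrite ==-refl x | ==-refl y = ∨-zeroʳ _

  isPair-false : {x y a b : Fin n} → ¬ SameEdge (x , y) (a , b) → isPair x y a b ≡ false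
  isPair-false {x} {y} {a} {b} ne with isPair x y a b in e
  ... | true  = ⊥-elim (ne (isPair-sound e))
  ... | false = refl

loopless : ∀ {n} {G : Adj n} → IsSimple G → {a b : Fin n} → G a b ≡ true → a ≢ b
loopless (_ , no-loop) e refl with trans (sym e) (no-loop _)
... | ()

module Join {n n'} (X : Adj n) (X' : Adj n') (u v : Fin n) (u' v' : Fin n') where

  Y : Adj (n + n')
  Y = joinY X X' u v u' v'

  uu' vv' : Pair (n + n')
  uu' = u ↑ˡ n' , n ↑ʳ u'
  vv' = v ↑ˡ n' , n ↑ʳ v'

  Y-left : ∀ x y → Y (x ↑ˡ n') (y ↑ˡ n') ≡ X x y ∧ not (isPair x y u v)
  Y-left x y rewrite splitAt-↑ˡ n x n' | splitAt-↑ˡ n y n' = refl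

  Y-right : ∀ x y → Y (n ↑ʳ x) (n ↑ʳ y) ≡ X' x y ∧ not (isPair x y u' v')
  Y-right x y rewrite splitAt-↑ʳ n n' x | splitAt-↑ʳ n n' y = refl

  Y-cross : ∀ x y → Y (x ↑ˡ n') (n ↑ʳ y) ≡ (x == u ∧ y == u') ∨ (x == v ∧ y == v')
  Y-cross x y rewrite splitAt-↑ˡ n x n' | splitAt-↑ʳ n n' y = refl

  Y-cross' : ∀ x y → Y (n ↑ʳ y) (x ↑ˡ n') ≡ (x == u ∧ y == u') ∨ (x == v ∧ y == v')
  Y-cross' x y rewrite splitAt-↑ˡ n x n' | splitAt-↑ʳ n n' y = refl

  Y-embL : ∀ {x y} → X x y ≡ true → ¬ SameEdge (x , y) (u , v) → Y (x ↑ˡ n') (y ↑ˡ n') ≡ true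
  Y-embL {x} {y} e ne rewrite Y-left x y | e | isPair-false ne = refl

  Y-embR : ∀ {x y} → X' x y ≡ true → ¬ SameEdge (x , y) (u' , v') → Y (n ↑ʳ x) (n ↑ʳ y) ≡ true
  Y-embR {x} {y} e ne rewrite Y-right x y | e | isPair-false ne = refl

  uu'-edge : Y (u ↑ˡ n') (n ↑ʳ u') ≡ true
  uu'-edge rewrite Y-cross u u' | ==-refl u | ==-refl u' = refl

  vv'-edge : Y (v ↑ˡ n') (n ↑ʳ v') ≡ true
  vv'-edge rewrite Y-cross v v' | ==-refl v | ==-refl v' = ∨-zeroʳ _

  uu'-edge' : Y (n ↑ʳ u') (u ↑ˡ n') ≡ true
  uu'-edge' = trans (Y-cross' u u') (trans (sym (Y-cross u u')) uu'-edge)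

  vv'-edge' : Y (n ↑ʳ v') (v ↑ˡ n') ≡ true
  vv'-edge' = trans (Y-cross' v v') (trans (sym (Y-cross v v')) vv'-edge)

  data YEdge : Pair (n + n') → Set where
    from-X  : ∀ x y → X x y ≡ true → ¬ SameEdge (x , y) (u , v) → YEdge (x ↑ˡ n' , y ↑ˡ n')
    from-X' : ∀ x y → X' x y ≡ true → ¬ SameEdge (x , y) (u' , v') → YEdge (n ↑ʳ x , n ↑ʳ y)
    new-u   : YEdge uu'
    new-v   : YEdge vv'

  cross-edge : ∀ {x y} → ((x == u ∧ y == u') ∨ (x == v ∧ y == v')) ≡ true → YEdge (x ↑ˡ n' , n ↑ʳ y)
  cross-edge {x} {y} e with ∨-true e
  ... | inj₁ e₁ with ∧-true e₁
  ...   | p , q with ==-sound {a = x} p | ==-sound {a = y} q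
  ...     | refl | refl = new-u
  cross-edge {x} {y} e | inj₂ e₂ with ∧-true e₂
  ...   | p , q with ==-sound {a = x} p | ==-sound {a = y} q
  ...     | refl | refl = new-v

  Y-edges : ∀ q → IsEdge Y q → Σ (Pair (n + n')) λ r → YEdge r × SameEdge q r
  Y-edges (w₁ , w₂) e with side {n} {n'} w₁ | side {n} {n'} w₂
  ... | left x  | left y  = let (xy , not-uv) = ∧-true (trans (sym (Y-left x y)) e) in
    _ , from-X x y xy (λ s → not-true not-uv (isPair-true s)) , same-refl _
  ... | right x | right y = let (xy , not-uv) = ∧-true (trans (sym (Y-right x y)) e) in
    _ , from-X' x y xy (λ s → not-true not-uv (isPair-true s)) , same-refl _
  ... | left x  | right y = _ , cross-edge (trans (sym (Y-cross x y)) e) , same-refl _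
  ... | right y | left x  = _ , cross-edge (trans (sym (Y-cross' x y)) e) , same-swap _ _

  -- projections of Y onto X and onto X': the other side collapses onto
  -- one edge, so that both new edges are sent to uv, resp. to u'v'
  π : Fin (n + n') → Fin n
  π w = collapse (splitAt n w)
    where
    collapse : Fin n ⊎ Fin n' → Fin n
    collapse (inj₁ x) = x
    collapse (inj₂ y) = if y == u' then v else u

  π' : Fin (n + n') → Fin n'
  π' w = collapse (splitAt n w)
    where
    collapse : Fin n ⊎ Fin n' → Fin n'
    collapse (inj₁ x) = if x == u then v' else u'
    collapse (inj₂ y) = y

  π-↑ˡ : ∀ x → π (x ↑ˡ n') ≡ x
  π-↑ˡ x rewrite splitAt-↑ˡ n x n' = refl

  π'-↑ʳ : ∀ y → π' (n ↑ʳ y) ≡ y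
  π'-↑ʳ y rewrite splitAt-↑ʳ n n' y = refl

  π-uu' : mapPair π uu' ≡ (u , v)
  π-uu' rewrite splitAt-↑ˡ n u n' | splitAt-↑ʳ n n' u' | ==-refl u' = refl

  π-vv' : u' ≢ v' → mapPair π vv' ≡ (v , u)
  π-vv' u'≢v' rewrite splitAt-↑ˡ n v n' | splitAt-↑ʳ n n' v'
                    | ==-false {a = v'} {b = u'} (λ e → u'≢v' (sym e)) = refl

  π'-uu' : mapPair π' uu' ≡ (v' , u')
  π'-uu' rewrite splitAt-↑ˡ n u n' | splitAt-↑ʳ n n' u' | ==-refl u = refl

  π'-vv' : u ≢ v → mapPair π' vv' ≡ (u' , v')
  π'-vv' u≢v rewrite splitAt-↑ˡ n v n' | splitAt-↑ʳ n n' v'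
                   | ==-false {a = v} {b = u} (λ e → u≢v (sym e)) = refl

  cross-nbhd : ∀ x y → Y (x ↑ˡ n') (n ↑ʳ y) ≡ true →
    ∀ b → InNbhd Y (x ↑ˡ n') (b ↑ˡ n') (x ↑ˡ n' , n ↑ʳ y)
  cross-nbhd x y e b = n ↑ʳ y , (λ eq → left≢right b y (sym eq)) , e , same-refl _

  cross-nbhd' : ∀ x y → Y (n ↑ʳ y) (x ↑ˡ n') ≡ true →
    ∀ b → InNbhd Y (n ↑ʳ y) (n ↑ʳ b) (x ↑ˡ n' , n ↑ʳ y)
  cross-nbhd' x y e b = x ↑ˡ n' , left≢right x b , e , same-swap _ _

  touchesX : Pair (n + n') × Pair (n + n') → Bool
  touchesX (p , q) = isLeftEdge {n} {n'} p ∨ isLeftEdge {n} {n'} q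

  touchesX-same : {P Q : Pair (n + n') × Pair (n + n')} → SameLEdge P Q → touchesX P ≡ touchesX Q
  touchesX-same (inj₁ (s , t)) = cong₂ _∨_ (isLeftEdge-same {n} {n'} s) (isLeftEdge-same {n} {n'} t)
  touchesX-same {Q = e' , f'} (inj₂ (s , t)) =
    trans (cong₂ _∨_ (isLeftEdge-same {n} {n'} s) (isLeftEdge-same {n} {n'} t))
          (∨-comm (isLeftEdge {n} {n'} f') (isLeftEdge {n} {n'} e'))

  new-edges-differ : u ≢ v → ¬ SameEdge vv' uu'
  new-edges-differ u≢v (inj₁ (e , _)) = u≢v (sym (↑ˡ-injective n' v u e))
  new-edges-differ u≢v (inj₂ (e , _)) = left≢right v u' e

-- One half of the spliced cycle: an anchored cycle of L(G), carried into
-- L(Y) by a vertex embedding ι with retraction ρ, whose edge st at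
-- position 0 is replaced by a new edge r of Y.
-- The spliced cycle runs through two such halves; r' is the new edge that
-- follows the last position of this half.

module Half {n N} {G : Adj n} {Y : Adj N} (ι : Fin n → Fin N) (ρ : Fin N → Fin n)
  (ρι : ∀ x → ρ (ι x) ≡ x)
  {L} {C : CycleL G L} {s t : Fin n} (A : Anchored C s t) (r r' : Pair N)
  (ι-edge  : ∀ {x y} → G x y ≡ true → ¬ SameEdge (x , y) (s , t) → Y (ι x) (ι y) ≡ true)
  (r-edge  : IsEdge Y r)
  (r-nbhd  : ∀ b → InNbhd Y (ι t) (ι b) r)
  (r'-nbhd : ∀ b → InNbhd Y (ι s) (ι b) r')
  (ρr      : SameEdge (mapPair ρ r) (s , t))
  (ρr'     : SameEdge (mapPair ρ r') (s , t))
  where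

  open Anchored A

  half : Fin (suc (suc (suc m))) → Pair N
  half zero    = r
  half (suc k) = mapPair ι (seq tour (suc k))

  half-≢0 : ∀ k → k ≢ zero → half k ≡ mapPair ι (seq tour k)
  half-≢0 zero    k≢0 = ⊥-elim (k≢0 refl)
  half-≢0 (suc k) _   = refl

  not-st : ∀ k → k ≢ zero → ¬ SameEdge (seq tour k) (s , t)
  not-st k k≢0 st = k≢0 (seq-injective tour (same-trans st (same-sym at-zero)))

  ι-injective : ∀ x y → ι x ≡ ι y → x ≡ y
  ι-injective x y e = trans (sym (ρι x)) (trans (cong ρ e) (ρι y))

  half-edge : ∀ k → IsEdge Y (half k)
  half-edge zero    = r-edge
  half-edge (suc k) = ι-edge (seq-edge tour (suc k)) (not-st (suc k) λ ())

  nbhd-map : ∀ {a b p} → InNbhd G a b p → ¬ SameEdge p (s , t) → InNbhd Y (ι a) (ι b) (mapPair ι p)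
  nbhd-map (α , α≢b , e , p≈aα) ne =
    ι α , (λ eq → α≢b (ι-injective _ _ eq)) , ι-edge e (λ s' → ne (same-trans p≈aα s')) ,
    mapPair-same ι p≈aα

  half-consec : ∀ k → k ≢ last → ShareEnd (half k) (half (cnext k))
  half-consec zero 0≢last = subst (ShareEnd r) (sym (half-≢0 _ (cnext≢zero zero 0≢last)))
    (share-at (nbhd-incident Y (r-nbhd t)) (mapPair-incident ι (nbhd-incident G after)))
  half-consec (suc k) k≢last = subst (ShareEnd _) (sym (half-≢0 _ (cnext≢zero (suc k) k≢last)))
    (mapPair-share ι (seq-consec tour (suc k)))

  last-consec : ShareEnd (half last) r'
  last-consec = subst (λ z → ShareEnd z r') (sym (half-≢0 last last≢zero))
    (share-at (mapPair-incident ι (nbhd-incident G before)) (nbhd-incident Y (r'-nbhd s)))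

  half-project : ∀ k → SameEdge (mapPair ρ (half k)) (seq tour k)
  half-project zero    = same-trans ρr (same-sym at-zero)
  half-project (suc k) = same-≡ (cong₂ _,_ (ρι _) (ρι _))

  at-wrap : SameEdge (seq tour (cnext last)) (s , t)
  at-wrap = subst (λ z → SameEdge (seq tour z) (s , t)) (sym cnext-last) at-zero

  last-project : SameEdge (mapPair ρ r') (seq tour (cnext last))
  last-project = same-trans ρr' (same-sym at-wrap)

  -- When
  -- the neighbour in G is st itself (k is position 1, resp. the last one),
  -- ab meets st at t, resp. at s, and the new edge r, resp. r', attached
  -- there takes its place.
  prev-nbhd : ∀ {a b} k → k ≢ zero → SameEdge (seq tour k) (a , b) →
    InNbhd G a b (seq tour (cprev k)) → InNbhd Y (ι a) (ι b) (half (cprev k))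
  prev-nbhd {a} {b} k k≢0 k≈ab nb with cprev k ≟ zero
  ... | no  p≢0 = subst (InNbhd Y (ι a) (ι b)) (sym (half-≢0 _ p≢0)) (nbhd-map nb (not-st _ p≢0))
  ... | yes p≡0 = subst (InNbhd Y (ι a) (ι b)) (cong half (sym p≡0))
                    (subst (λ z → InNbhd Y (ι z) (ι b) r) (sym a≡t) (r-nbhd b))
    where
    k≡1 : k ≡ cnext zero
    k≡1 = trans (sym (cnext-cprev k)) (cong cnext p≡0)
    a≡t : a ≡ t
    a≡t = let (β , β≢s , _ , 1≈tβ) = after in
      nbhd-endpoint G nb (subst (λ z → SameEdge (seq tour z) (s , t)) (sym p≡0) at-zero)
        (same-trans (same-sym k≈ab) (subst (λ z → SameEdge (seq tour z) (t , β)) (sym k≡1) 1≈tβ))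
        β≢s

  next-nbhd : ∀ {a b} k → k ≢ last →
    InNbhd G a b (seq tour (cnext k)) → InNbhd Y (ι a) (ι b) (half (cnext k))
  next-nbhd {a} {b} k k≢last nb =
    subst (InNbhd Y (ι a) (ι b)) (sym (half-≢0 _ n≢0)) (nbhd-map nb (not-st _ n≢0))
    where n≢0 = cnext≢zero k k≢last

  last-next-nbhd : ∀ {a b} → SameEdge (seq tour last) (a , b) →
    InNbhd G a b (seq tour (cnext last)) → InNbhd Y (ι a) (ι b) r'
  last-next-nbhd {a} {b} last≈ab nb = subst (λ z → InNbhd Y (ι z) (ι b) r') (sym a≡s) (r'-nbhd b)
    where
    a≡s : a ≡ s
    a≡s = let (α , α≢t , _ , last≈sα) = before in
      nbhd-endpoint G nb (same-trans at-wrap (same-swap s t)) (same-trans (same-sym last≈ab) last≈sα) α≢t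

module Splice {n n'} {X : Adj n} {X' : Adj n'} {u v : Fin n} {u' v' : Fin n'}
  (u≢v : u ≢ v) (u'≢v' : u' ≢ v')
  {L L'} {C : CycleL X L} {C' : CycleL X' L'} (A : Anchored C u v) (A' : Anchored C' v' u') where

  open Join X X' u v u' v'
  open Anchored A using (m; tour)
  open Anchored A' using () renaming (m to m'; tour to tour')

  K K' : ℕ
  K  = suc (suc (suc m))
  K' = suc (suc (suc m'))

  -- the right half is anchored at v'u' rather than u'v'
  Y-embR' : ∀ {x y} → X' x y ≡ true → ¬ SameEdge (x , y) (v' , u') → Y (n ↑ʳ x) (n ↑ʳ y) ≡ true
  Y-embR' e ne = Y-embR e (λ s → ne (same-trans s (same-swap u' v')))

  module H = Half {Y = Y} (_↑ˡ n') π π-↑ˡ A vv' uu' Y-embL vv'-edge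
    (cross-nbhd v v' vv'-edge) (cross-nbhd u u' uu'-edge)
    (same-trans (same-≡ (π-vv' u'≢v')) (same-swap v u)) (same-≡ π-uu')
  module H' = Half {Y = Y} (n ↑ʳ_) π' π'-↑ʳ A' uu' vv' Y-embR' uu'-edge
    (cross-nbhd' u u' uu'-edge') (cross-nbhd' v v' vv'-edge')
    (same-≡ π'-uu') (same-trans (same-≡ (π'-vv' u≢v)) (same-swap u' v'))

  spliced : Fin (K + K') → Pair (n + n')
  spliced j = glue (splitAt K j)
    where
    glue : Fin K ⊎ Fin K' → Pair (n + n')
    glue (inj₁ i) = H.half i
    glue (inj₂ i) = H'.half i

  spliced-↑ˡ : ∀ i → spliced (i ↑ˡ K') ≡ H.half i
  spliced-↑ˡ i rewrite splitAt-↑ˡ K i K' = refl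

  spliced-↑ʳ : ∀ i → spliced (K ↑ʳ i) ≡ H'.half i
  spliced-↑ʳ i rewrite splitAt-↑ʳ K K' i = refl

  prev-↑ˡ : ∀ i → i ≢ zero → spliced (cprev (i ↑ˡ K')) ≡ H.half (cprev i)
  prev-↑ˡ i i≢0 = trans (cong spliced (cprev-↑ˡ {b = K'} i i≢0)) (spliced-↑ˡ (cprev i))

  next-↑ˡ : ∀ i → i ≢ last → spliced (cnext (i ↑ˡ K')) ≡ H.half (cnext i)
  next-↑ˡ i i≢last = trans (cong spliced (cnext-↑ˡ {b = K'} i i≢last)) (spliced-↑ˡ (cnext i))

  next-↑ˡ-last : spliced (cnext (last {suc (suc m)} ↑ˡ K')) ≡ uu'
  next-↑ˡ-last = trans (cong spliced (cnext-↑ˡ-last {suc (suc m)} {suc (suc m')})) (spliced-↑ʳ zero)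

  next-↑ʳ : ∀ i → i ≢ last → spliced (cnext (K ↑ʳ i)) ≡ H'.half (cnext i)
  next-↑ʳ i i≢last = trans (cong spliced (cnext-↑ʳ {a = K} i i≢last)) (spliced-↑ʳ (cnext i))

  next-↑ʳ-last : spliced (cnext (K ↑ʳ last {suc (suc m')})) ≡ vv'
  next-↑ʳ-last = trans (cong spliced (cnext-↑ʳ-last {suc (suc m)} {suc (suc m')})) (spliced-↑ˡ zero)

  spliced-edge : ∀ j → IsEdge Y (spliced j)
  spliced-edge j with side {K} {K'} j
  ... | left i  = subst (IsEdge Y) (sym (spliced-↑ˡ i)) (H.half-edge i)
  ... | right i = subst (IsEdge Y) (sym (spliced-↑ʳ i)) (H'.half-edge i)

  spliced-consec : ∀ j → ShareEnd (spliced j) (spliced (cnext j))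
  spliced-consec j with side {K} {K'} j
  ... | left i with i ≟ last
  ...   | yes refl = subst₂ ShareEnd (sym (spliced-↑ˡ last)) (sym next-↑ˡ-last) H.last-consec
  ...   | no i≢last = subst₂ ShareEnd (sym (spliced-↑ˡ i)) (sym (next-↑ˡ i i≢last)) (H.half-consec i i≢last)
  spliced-consec j | right i with i ≟ last
  ...   | yes refl = subst₂ ShareEnd (sym (spliced-↑ʳ last)) (sym next-↑ʳ-last) H'.last-consec
  ...   | no i≢last = subst₂ ShareEnd (sym (spliced-↑ʳ i)) (sym (next-↑ʳ i i≢last)) (H'.half-consec i i≢last)

  halves-differ : ∀ i i' → ¬ SameEdge (H.half i) (H'.half i')
  halves-differ zero    zero     = new-edges-differ u≢v
  halves-differ zero    (suc i') = cross≁right v v' (seq tour' (suc i'))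
  halves-differ (suc i) zero     = left≁cross (seq tour (suc i)) u u'
  halves-differ (suc i) (suc i') = left≁right (seq tour (suc i)) (seq tour' (suc i'))

  spliced-injective : ∀ j j' → SameEdge (spliced j) (spliced j') → j ≡ j'
  spliced-injective j j' s with side {K} {K'} j | side {K} {K'} j'
  ... | left i  | left i'  = cong (_↑ˡ K') (seq-injective tour
    (same-trans (same-sym (H.half-project i)) (same-trans (mapPair-same π s') (H.half-project i'))))
    where s' = subst₂ SameEdge (spliced-↑ˡ i) (spliced-↑ˡ i') s
  ... | right i | right i' = cong (K ↑ʳ_) (seq-injective tour'
    (same-trans (same-sym (H'.half-project i)) (same-trans (mapPair-same π' s') (H'.half-project i'))))
    where s' = subst₂ SameEdge (spliced-↑ʳ i) (spliced-↑ʳ i') s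
  ... | left i  | right i' = ⊥-elim (halves-differ i i' (subst₂ SameEdge (spliced-↑ˡ i) (spliced-↑ʳ i') s))
  ... | right i | left i'  = ⊥-elim (halves-differ i' i (subst₂ SameEdge (spliced-↑ˡ i') (spliced-↑ʳ i) (same-sym s)))

  spliced-hits : ∀ {q} → YEdge q → Σ (Fin (K + K')) λ j → SameEdge (spliced j) q
  spliced-hits (from-X x y e ne) = let (i , i≈xy , _) = seq-covers tour (x , y) e in
    i ↑ˡ K' , subst (λ z → SameEdge z _) (sym (trans (spliced-↑ˡ i) (H.half-≢0 i (i≢0 i i≈xy))))
                (mapPair-same (_↑ˡ n') i≈xy)
    where
    i≢0 : ∀ i → SameEdge (seq tour i) (x , y) → i ≢ zero
    i≢0 i i≈xy refl = ne (same-trans (same-sym i≈xy) (Anchored.at-zero A))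
  spliced-hits (from-X' x y e ne) = let (i , i≈xy , _) = seq-covers tour' (x , y) e in
    K ↑ʳ i , subst (λ z → SameEdge z _) (sym (trans (spliced-↑ʳ i) (H'.half-≢0 i (i≢0 i i≈xy))))
               (mapPair-same (n ↑ʳ_) i≈xy)
    where
    i≢0 : ∀ i → SameEdge (seq tour' i) (x , y) → i ≢ zero
    i≢0 i i≈xy refl = ne (same-trans (same-sym i≈xy) (same-trans (Anchored.at-zero A') (same-swap v' u')))
  spliced-hits new-u = K ↑ʳ zero , same-≡ (spliced-↑ʳ zero)
  spliced-hits new-v = zero {suc (suc m)} ↑ˡ K' , same-≡ (spliced-↑ˡ zero)

  spliced-covers : Covers Y spliced
  spliced-covers q e =
    let (r , yr , q≈r) = Y-edges q e ; (j , j≈r) = spliced-hits yr in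
    j , same-trans j≈r (same-sym q≈r) ,
    λ j' j'≈q → spliced-injective j' j (same-trans j'≈q (same-trans q≈r (same-sym j≈r)))

  cycle : CycleL Y (K + K')
  cycle = record
    { seq = spliced ; seq-edge = spliced-edge ; seq-covers = spliced-covers ; seq-consec = spliced-consec }

  Origin : Pair (n + n') × Pair (n + n') → Set
  Origin P = (touchesX P ≡ true  × Σ (Fin K)  λ i → SameLEdge (mapLEdge π P) (lstep tour i))
           ⊎ (touchesX P ≡ false × Σ (Fin K') λ i → SameLEdge (mapLEdge π' P) (lstep tour' i))

  -- no edge of the right half lies inside X; an L-edge of the left half
  -- always has an end inside X (position 1 if not position 0)
  right-half-not-left : ∀ i → isLeftEdge {n} {n'} (H'.half i) ≡ false
  right-half-not-left zero    = isLeftEdge-cross {n} {n'} u u'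
  right-half-not-left (suc i) = isLeftEdge-↑ʳ {n} {n'} (seq tour' (suc i))

  touches-↑ˡ : ∀ i → touchesX (lstep cycle (i ↑ˡ K')) ≡ true
  touches-↑ˡ i with i ≟ zero
  ... | no i≢0 = ∨-trueˡ (trans (cong (isLeftEdge {n} {n'}) (trans (spliced-↑ˡ i) (H.half-≢0 i i≢0)))
                               (isLeftEdge-↑ˡ {n} {n'} (seq tour i)))
  ... | yes refl = ∨-trueʳ (trans (cong (isLeftEdge {n} {n'}) (trans (next-↑ˡ zero 0≢last) (H.half-≢0 _ 1≢0)))
                                 (isLeftEdge-↑ˡ {n} {n'} (seq tour (cnext zero))))
    where
    0≢last : zero ≢ last
    0≢last e = last≢zero (sym e)
    1≢0 : cnext zero ≢ zero
    1≢0 = cnext≢zero zero 0≢last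

  next-↑ʳ-not-left : ∀ i → isLeftEdge {n} {n'} (spliced (cnext (K ↑ʳ i))) ≡ false
  next-↑ʳ-not-left i with i ≟ last
  ... | yes refl   = trans (cong (isLeftEdge {n} {n'}) next-↑ʳ-last) (isLeftEdge-cross {n} {n'} v v')
  ... | no i≢last  = trans (cong (isLeftEdge {n} {n'}) (next-↑ʳ i i≢last)) (right-half-not-left (cnext i))

  touches-↑ʳ : ∀ i → touchesX (lstep cycle (K ↑ʳ i)) ≡ false
  touches-↑ʳ i = cong₂ _∨_ (trans (cong (isLeftEdge {n} {n'}) (spliced-↑ʳ i)) (right-half-not-left i))
                           (next-↑ʳ-not-left i)

  project-next-↑ˡ : ∀ i → SameEdge (mapPair π (spliced (cnext (i ↑ˡ K')))) (seq tour (cnext i))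
  project-next-↑ˡ i with i ≟ last
  ... | yes refl  = subst (λ z → SameEdge (mapPair π z) _) (sym next-↑ˡ-last) H.last-project
  ... | no i≢last = subst (λ z → SameEdge (mapPair π z) _) (sym (next-↑ˡ i i≢last)) (H.half-project (cnext i))

  project-next-↑ʳ : ∀ i → SameEdge (mapPair π' (spliced (cnext (K ↑ʳ i)))) (seq tour' (cnext i))
  project-next-↑ʳ i with i ≟ last
  ... | yes refl  = subst (λ z → SameEdge (mapPair π' z) _) (sym next-↑ʳ-last) H'.last-project
  ... | no i≢last = subst (λ z → SameEdge (mapPair π' z) _) (sym (next-↑ʳ i i≢last)) (H'.half-project (cnext i))

  origin : ∀ j → Origin (lstep cycle j)
  origin j with side {K} {K'} j
  ... | left i  = inj₁ (touches-↑ˡ i , i , inj₁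
    (subst (λ z → SameEdge (mapPair π z) _) (sym (spliced-↑ˡ i)) (H.half-project i) , project-next-↑ˡ i))
  ... | right i = inj₂ (touches-↑ʳ i , i , inj₁
    (subst (λ z → SameEdge (mapPair π' z) _) (sym (spliced-↑ʳ i)) (H'.half-project i) , project-next-↑ʳ i))

  nbhd-prev-↑ˡ : ∀ {a b} i → i ≢ zero → SameEdge (seq tour i) (a , b) →
    InNbhd X a b (seq tour (cprev i)) → InNbhd Y (a ↑ˡ n') (b ↑ˡ n') (spliced (cprev (i ↑ˡ K')))
  nbhd-prev-↑ˡ {a} {b} i i≢0 i≈ab nb =
    subst (InNbhd Y (a ↑ˡ n') (b ↑ˡ n')) (sym (prev-↑ˡ i i≢0)) (H.prev-nbhd i i≢0 i≈ab nb)

  nbhd-next-↑ˡ : ∀ {a b} i → SameEdge (seq tour i) (a , b) →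
    InNbhd X a b (seq tour (cnext i)) → InNbhd Y (a ↑ˡ n') (b ↑ˡ n') (spliced (cnext (i ↑ˡ K')))
  nbhd-next-↑ˡ {a} {b} i i≈ab nb with i ≟ last
  ... | yes refl  = subst (InNbhd Y (a ↑ˡ n') (b ↑ˡ n')) (sym next-↑ˡ-last) (H.last-next-nbhd i≈ab nb)
  ... | no i≢last = subst (InNbhd Y (a ↑ˡ n') (b ↑ˡ n')) (sym (next-↑ˡ i i≢last)) (H.next-nbhd i i≢last nb)

  spliced-etc : ∀ {x y} → ETC tour (x , y) → ETC cycle (x ↑ˡ n' , y ↑ˡ n')
  spliced-etc {x} {y} E j j≈xy with side {K} {K'} j
  ... | right i = ⊥-elim (true-and-false (isLeftEdge-↑ˡ {n} {n'} (x , y))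
      (trans (sym (isLeftEdge-same {n} {n'} j≈xy)) (trans (cong (isLeftEdge {n} {n'}) (spliced-↑ʳ i)) (right-half-not-left i))))
  ... | left i with i ≟ zero
  ...   | yes refl = ⊥-elim (left≁cross (x , y) v v' (same-sym (subst (λ z → SameEdge z _) (spliced-↑ˡ zero) j≈xy)))
  ...   | no i≢0 = flanked-transfer {G = X} {Y = Y} (_↑ˡ n')
            (λ xy≈ab → nbhd-prev-↑ˡ i i≢0 (same-trans i≈xy xy≈ab))
            (λ xy≈ab → nbhd-next-↑ˡ i (same-trans i≈xy xy≈ab))
            (E i i≈xy)
    where
    i≈xy : SameEdge (seq tour i) (x , y)
    i≈xy = mapPair-same⁻ (_↑ˡ n') (↑ˡ-injective n')
             (subst (λ z → SameEdge z _) (trans (spliced-↑ˡ i) (H.half-≢0 i i≢0)) j≈xy)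

-- Splicing the cycles of two decompositions colour by colour gives a
-- Hamilton decomposition of L(Y): an L-edge shared by the splices of two
-- colours would, according to whether it touches X, project under π or π'
-- to an L-edge shared by two anchored cycles of the same decomposition.

module SplicedDecomposition {k n n'} {X : Adj n} {X' : Adj n'} {u v : Fin n} {u' v' : Fin n'}
  (u≢v : u ≢ v) (u'≢v' : u' ≢ v') (𝓗 : HamDecompL k X) (𝓗' : HamDecompL k X')
  (A  : ∀ a → Anchored (fromHam (cyc 𝓗 a)) u v)
  (A' : ∀ a → Anchored (fromHam (cyc 𝓗' a)) v' u') where

  open Join X X' u v u' v' using (Y; π; π'; touchesX-same)
  module S (a : Fin (k ∸ 1)) = Splice u≢v u'≢v' (A a) (A' a)

  cycles : Fin (k ∸ 1) → HamCycleL Y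
  cycles a = toHam (s≤s (s≤s (s≤s z≤n))) (S.cycle a)

  spliced-disjoint : ∀ a b → a ≢ b → EdgeDisjoint (cycles a) (cycles b)
  spliced-disjoint a b a≢b i j shared with S.origin a i | S.origin b j
  ... | inj₁ (_ , i' , i≈) | inj₁ (_ , j' , j≈) = anchored-disjoint 𝓗 A a b a≢b i' j'
        (sameL-trans (sameL-sym i≈) (sameL-trans (mapLEdge-same π shared) j≈))
  ... | inj₂ (_ , i' , i≈) | inj₂ (_ , j' , j≈) = anchored-disjoint 𝓗' A' a b a≢b i' j'
        (sameL-trans (sameL-sym i≈) (sameL-trans (mapLEdge-same π' shared) j≈))
  ... | inj₁ (touches , _) | inj₂ (misses , _) = true-and-false touches (trans (touchesX-same shared) misses)
  ... | inj₂ (misses , _) | inj₁ (touches , _) = true-and-false touches (trans (sym (touchesX-same shared)) misses)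

  decomposition : HamDecompL k Y
  decomposition = record { cyc = cycles ; disjoint = spliced-disjoint }

lemma4 : (k n n' : ℕ) (X : Adj n) (X' : Adj n') →
    IsSimple X → IsSimple X' → IsRegular k X → IsRegular k X' →
    (u v : Fin n) (u' v' : Fin n') → X u v ≡ true → X' u' v' ≡ true →
    (𝓗 : HamDecompL k X) → ETCompat 𝓗 (u , v) →
    (𝓗' : HamDecompL k X') → ETCompat 𝓗' (u' , v') →
    Σ (HamDecompL k (joinY X X' u v u' v')) λ 𝓗* →
      ∀ x y → X x y ≡ true → ¬ SameEdge (x , y) (u , v) →
        ETCompat 𝓗 (x , y) → ETCompat 𝓗* (embL n' (x , y))
lemma4 k n n' X X' simpleX simpleX' _ _ u v u' v' uv∈X u'v'∈X' 𝓗 etc-uv 𝓗' etc-u'v' =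
  SD.decomposition , etc-old
  where
  A : ∀ a → Anchored (fromHam (cyc 𝓗 a)) u v
  A a = anchor (fromHam (cyc 𝓗 a)) (len≥3 (cyc 𝓗 a)) uv∈X (etc-uv a)

  A' : ∀ a → Anchored (fromHam (cyc 𝓗' a)) v' u'
  A' a = anchor (fromHam (cyc 𝓗' a)) (len≥3 (cyc 𝓗' a)) (trans (proj₁ simpleX' v' u') u'v'∈X')
                (etc-swap (fromHam (cyc 𝓗' a)) (etc-u'v' a))

  module SD = SplicedDecomposition (loopless simpleX uv∈X) (loopless simpleX' u'v'∈X') 𝓗 𝓗' A A'

  etc-old : ∀ x y → X x y ≡ true → ¬ SameEdge (x , y) (u , v) →
    ETCompat 𝓗 (x , y) → ETCompat SD.decomposition (embL n' (x , y))
  etc-old x y _ _ etc-xy a = SD.S.spliced-etc a (etc-from (Anchored.refines (A a)) (x , y) (etc-xy a))
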